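{- Let $n\ge 4$. Then $E(\mathcal{PSC}_n^{1,0})=\{2t: t\in[1,\lfloor\frac{n-1}{2}\rfloor]\}$.
   Context: For $n\ge 3$, let $C_n$ be the set of $n\times n$ real matrices $A$ whose row $i$ ($1\le i\le n-1$) has a single entry $1$ in column $i+1$ and zeros elsewhere, and whose last row has all entries in $\{0,1\}$. For $A\in C_n$ put $F(A)=A+A^T$. For $\alpha,\mathbf e\in\{0,1\}$ let $C_n^{\alpha,\mathbf e}=\{F(A): A\in C_n,\ a_{n,1}=\alpha,\ a_{n,n}=\mathbf e\}$ and $\mathcal{PSC}_n^{\alpha,\mathbf e}$ the set of primitive matrices in it (primitive: some power is entrywise positive; exponent: least such power). For a set $X$ of matrices, $E(X)$ is the set of exponents of the primitive matrices in $X$. $[a,b]$ denotes the set of integers $k$ with $a\le k\le b$. -}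

module Defs where

open import Data.Nat using (ℕ; zero; suc; _+_; _*_; _∸_; _<_; _≤_; _≤ᵇ_; _≡ᵇ_)
open import Data.Nat.DivMod using (_/_)
open import Data.Fin using (Fin; toℕ)
import Data.Fin as F
open import Data.Bool using (Bool; true; false; if_then_else_)
open import Data.Product using (Σ; ∃; _×_; _,_)
open import Relation.Binary.PropositionalEquality using (_≡_)

-- Square matrices of size n with natural-number entries (all matrices in
-- this problem are nonnegative integer matrices; products/powers over ℕ
-- coincide with those over ℝ).
Mat : ℕ → Set
Mat n = Fin n → Fin n → ℕ

sumFin : ∀ {n} → (Fin n → ℕ) → ℕ
sumFin {zero}  f = 0
sumFin {suc n} f = f F.zero + sumFin (λ i → f (F.suc i))

_⊗_ : ∀ {n} → Mat n → Mat n → Mat n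
(M ⊗ N) i j = sumFin (λ k → M i k * N k j)

idMat : ∀ {n} → Mat n
idMat i j = if toℕ i ≡ᵇ toℕ j then 1 else 0

_^ᴹ_ : ∀ {n} → Mat n → ℕ → Mat n
M ^ᴹ zero  = idMat
M ^ᴹ suc k = M ⊗ (M ^ᴹ k)

transpose : ∀ {n} → Mat n → Mat n
transpose M i j = M j i

_⊕_ : ∀ {n} → Mat n → Mat n → Mat n
(M ⊕ N) i j = M i j + N i j

Positive : ∀ {n} → Mat n → Set
Positive M = ∀ i j → 0 < M i j

Primitive : ∀ {n} → Mat n → Set
Primitive M = ∃ λ k → Positive (M ^ᴹ k)

IsExponent : ∀ {n} → Mat n → ℕ → Set
IsExponent M k = Positive (M ^ᴹ k) × (∀ m → Positive (M ^ᴹ m) → k ≤ m)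

b2n : Bool → ℕ
b2n true  = 1
b2n false = 0

-- The matrix A ∈ C_n determined by its last row b (entries in {0,1}):
-- row i (0-based, i < n-1) has a single 1 in column i+1; last row is b.
Cmat : (n : ℕ) → (Fin n → Bool) → Mat n
Cmat n b i j =
  if suc (toℕ i) ≤ᵇ (n ∸ 1)
  then (if toℕ j ≡ᵇ suc (toℕ i) then 1 else 0)
  else b2n (b j)

Fmap : ∀ {n} → Mat n → Mat n
Fmap A = A ⊕ transpose A

RowCond : (n : ℕ) → Bool → Bool → (Fin n → Bool) → Set
RowCond n α e b = (∀ j → toℕ j ≡ 0 → b j ≡ α) × (∀ j → toℕ j ≡ n ∸ 1 → b j ≡ e)

-- k ∈ E(PSC_n^{α,e}): k is the exponent of some primitive F(A), A ∈ C_n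
-- with a_{n,1} = α, a_{n,n} = e.
InE-PSC : (n : ℕ) → Bool → Bool → ℕ → Set
InE-PSC n α e k = Σ (Fin n → Bool) λ b →
  RowCond n α e b × Primitive (Fmap (Cmat n b)) × IsExponent (Fmap (Cmat n b)) k

-- F(A) is the adjacency matrix of the path 0 — 1 — ⋯ — N (N = n − 1) together with spokes
-- N — j for the j with a_{n,j+1} = 1; off the hub N it is bipartite by parity of the index.
-- So an odd closed walk passes through N, and its two halves are walks to N of both parities.
-- If every vertex has an odd closed walk of length K + 1 (K even), splicing these halves and
-- padding with back-and-forth steps gives walks of length K between any two vertices.
-- Hence an exponent is even (a positive odd power K + 1 makes the power K positive) and at most
-- N (every vertex lies on an odd closed walk through N of length at most N + 1, unless the graph
-- is properly 2-coloured, which contradicts primitivity). Conversely, with the spokes 0 and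
-- 2t − 1, …, N − 1 every vertex lies on an odd closed walk of length 2t + 1, while a closed walk
-- of length 2t − 1 at vertex t − 1 must either stay in the bipartite part 0, …, 2t − 2 (impossible,
-- its length is odd) or reach 2t − 1, which is t steps away.

module Submission where

open import Defs
open import Data.Nat using (ℕ; _≤_; _*_; _∸_; _/_)
open import Data.Bool using (true; false)
open import Data.Product using (∃; _×_)
open import Function.Bundles using (_⇔_)
open import Relation.Binary.PropositionalEquality using (_≡_)

open import Data.Bool as Bool using (Bool; not; _xor_; T)
open import Data.Bool.Properties
  using (not-involutive; not-distribˡ-xor; not-distribʳ-xor; xor-same; xor-identityʳ; not-¬; ¬-not)
open import Data.Empty using (⊥; ⊥-elim)
open import Data.Fin as Fin using (Fin; toℕ)
open import Data.Fin.Properties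
  using (any?; toℕ-injective; toℕ≤pred[n]; toℕ-fromℕ<; toℕ-fromℕ)
open import Data.Nat
  using (zero; suc; _+_; _<_; z≤n; s≤s; _≤?_; _<?_; _≡ᵇ_; _≤ᵇ_; _≟_; _⊓_; ∣_-_∣)
open import Data.Nat.DivMod using (m*n/n≡m; m/n*n≤m; /-monoˡ-≤)
open import Data.Nat.Properties
open import Data.Nat.Tactic.RingSolver using (solve-∀)
open import Data.Product using (_,_; proj₁; proj₂; uncurry)
open import Data.Sum as Sum using (_⊎_; inj₁; inj₂; [_,_]′)
open import Function using (_∘_; _∘₂_; case_of_)
open import Function.Bundles using (Equivalence; mk⇔)
open import Relation.Binary.Definitions using (Symmetric; DecidableEquality)
open import Relation.Binary.PropositionalEquality
  using (_≢_; refl; sym; trans; cong; cong₂; subst; module ≡-Reasoning)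
open import Relation.Nullary using (¬_; Dec; yes; no)
open import Relation.Nullary.Decidable using (_×-dec_; _⊎-dec_; does; dec-true; dec-false)
open import Relation.Nullary.Reflects using (ofʸ; ofⁿ)
open import Relation.Unary using (Decidable)

parity : ℕ → Bool
parity zero    = false
parity (suc n) = not (parity n)

parity-+ : ∀ m n → parity (m + n) ≡ parity m xor parity n
parity-+ zero    n = refl
parity-+ (suc m) n = trans (cong not (parity-+ m n)) (not-distribˡ-xor (parity m) (parity n))

parity-double : ∀ s → parity (s + s) ≡ false
parity-double s = trans (parity-+ s s) (xor-same (parity s))

parity≡false⇒double : ∀ n → parity n ≡ false → ∃ λ s → n ≡ s + s
parity≡false⇒double zero          _ = 0 , refl
parity≡false⇒double (suc zero)    ()
parity≡false⇒double (suc (suc n)) p with parity≡false⇒double n (trans (sym (not-involutive _)) p)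
... | s , refl = suc s , cong suc (sym (+-suc s s))

suc-parity-flip : ∀ {m n} → m ≡ suc n → parity n ≡ not (parity m)
suc-parity-flip {n = n} refl = sym (not-involutive (parity n))

odd⇒positive : ∀ {n} → parity n ≡ true → 0 < n
odd⇒positive {suc n} _ = s≤s z≤n

xor-fixpoint : ∀ x y → x ≡ x xor y → y ≡ false
xor-fixpoint true  true  ()
xor-fixpoint true  false _  = refl
xor-fixpoint false y     eq = sym eq

sameParity⇒+double : ∀ {m n} → m ≤ n → parity m ≡ parity n → ∃ λ s → n ≡ s + s + m
sameParity⇒+double {m} m≤n p with m≤n⇒∃[o]m+o≡n m≤n
... | o , refl with parity≡false⇒double o (xor-fixpoint _ _ (trans p (parity-+ m o)))
...   | s , refl = s , +-comm m (s + s)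

-- If two sums x, y of total 2(K+1) were both above K they would both equal K + 1,
-- which is impossible when x has the parity of K.
sameParity-split : ∀ {x y K} → x + y ≡ suc K + suc K → parity x ≡ parity K → x ≤ K ⊎ y ≤ K
sameParity-split {x} {y} {K} eq px with x ≤? K | y ≤? K
... | yes x≤K | _       = inj₁ x≤K
... | no _    | yes y≤K = inj₂ y≤K
... | no x≰K  | no y≰K  = ⊥-elim (not-¬ refl (trans (sym px) (cong parity x≡1+K)))
  where
  x≤1+K : x ≤ suc K
  x≤1+K = +-cancelʳ-≤ (suc K) x (suc K)
            (≤-trans (+-monoʳ-≤ x (≰⇒> y≰K)) (≤-reflexive (trans eq (+-comm (suc K) (suc K)))))
  x≡1+K : x ≡ suc K
  x≡1+K = ≤-antisym x≤1+K (≰⇒> x≰K)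

does⇒ : ∀ {A : Set} (a? : Dec A) → does a? ≡ true → A
does⇒ (yes a) _ = a

module Walks {V : Set} (_~_ : V → V → Set) where

  infixr 5 _∷_ _++_

  data Walk : ℕ → V → V → Set where
    []  : ∀ {i} → Walk 0 i i
    _∷_ : ∀ {k i l j} → i ~ l → Walk k l j → Walk (suc k) i j

  _++_ : ∀ {k l i j m} → Walk k i j → Walk l j m → Walk (k + l) i m
  []      ++ w′ = w′
  (e ∷ w) ++ w′ = e ∷ (w ++ w′)

  cast : ∀ {k l i j} → k ≡ l → Walk k i j → Walk l i j
  cast refl w = w

  Alternating : (V → Bool) → Set
  Alternating col = ∀ {x y} → x ~ y → col y ≡ not (col x)

  colour-step : ∀ (col : V → Bool) {i l j} p →
                col l ≡ not (col i) → col j ≡ col l xor p → col j ≡ col i xor not p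
  colour-step col {i} {l} {j} p l≡ j≡ = begin
    col j                  ≡⟨ j≡ ⟩
    col l xor p            ≡⟨ cong (_xor p) l≡ ⟩
    not (col i) xor p      ≡⟨ not-distribˡ-xor (col i) p ⟨
    not (col i xor p)      ≡⟨ not-distribʳ-xor (col i) p ⟩
    col i xor not p        ∎
    where open ≡-Reasoning

  alternating-walk : ∀ {col} → Alternating col →
                     ∀ {k i j} → Walk k i j → col j ≡ col i xor parity k
  alternating-walk       alt []      = sym (xor-identityʳ _)
  alternating-walk {col} alt (e ∷ w) = colour-step col _ (alt e) (alternating-walk alt w)

  alternating⇒¬equal-lengths : ∀ {col k x y} → Alternating col →
                               x ~ y → Walk k x x → Walk k x y → ⊥
  alternating⇒¬equal-lengths {col} {k} {x} {y} alt e closed open′ = not-¬ refl (begin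
    col y                ≡⟨ alternating-walk alt open′ ⟩
    col x xor parity k   ≡⟨ cong (col x xor_) k-even ⟩
    col x xor false      ≡⟨ xor-identityʳ (col x) ⟩
    col x                ≡⟨ sym (not-involutive (col x)) ⟩
    not (not (col x))    ≡⟨ cong not (alt e) ⟨
    not (col y)          ∎)
    where
    open ≡-Reasoning
    k-even : parity k ≡ false
    k-even = xor-fixpoint (col x) (parity k) (alternating-walk alt closed)

  record Via (X : V → Set) (k : ℕ) (i j : V) : Set where
    constructor via
    field
      pivot      : V
      pivot∈X    : X pivot
      before     : ℕ
      after      : ℕ
      lengths    : before + after ≡ k
      to-pivot   : Walk before i pivot
      from-pivot : Walk after pivot j

  module _ {X : V → Set} (X? : Decidable X) {col : V → Bool}
           (alternates : ∀ {x y} → ¬ X x → ¬ X y → x ~ y → col y ≡ not (col x)) where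

    private
      avoiding : ∀ {k i j} → ¬ X i → Walk k i j → Via X k i j ⊎ col j ≡ col i xor parity k
      avoiding _   []                = inj₂ (sym (xor-identityʳ _))
      avoiding i∉X (_∷_ {l = l} e w) with X? l
      ... | yes l∈X = inj₁ (via l l∈X 1 _ refl (e ∷ []) w)
      ... | no  l∉X =
        Sum.map extend (colour-step col _ (alternates i∉X l∉X e)) (avoiding l∉X w)
        where
        extend : ∀ {k j} → Via X k l j → Via X (suc k) _ j
        extend (via x x∈X a c eq w₁ w₂) = via x x∈X (suc a) c (cong suc eq) (e ∷ w₁) w₂

    meets-or-alternates : ∀ {k i j} → Walk k i j → Via X k i j ⊎ col j ≡ col i xor parity k
    meets-or-alternates {i = i} w with X? i
    ... | yes i∈X = inj₁ (via i i∈X 0 _ refl [] w)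
    ... | no  i∉X = avoiding i∉X w

  module _ (φ : V → ℕ) (lipschitz : ∀ {x y} → x ~ y → φ y ≤ suc (φ x)) where

    potential-≤ : ∀ {k i j} → Walk k i j → φ j ≤ k + φ i
    potential-≤             []      = ≤-refl
    potential-≤ {suc k} {i} (e ∷ w) = ≤-trans (potential-≤ w)
      (≤-trans (+-monoʳ-≤ k (lipschitz e)) (≤-reflexive (+-suc k (φ i))))

  module Undirected (~-sym : Symmetric _~_) (neighbour : ∀ i → ∃ (i ~_)) where

    _∷ʳ_ : ∀ {k i j l} → Walk k i j → j ~ l → Walk (suc k) i l
    []      ∷ʳ e′ = e′ ∷ []
    (e ∷ w) ∷ʳ e′ = e ∷ (w ∷ʳ e′)

    reverse : ∀ {k i j} → Walk k i j → Walk k j i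
    reverse []      = []
    reverse (e ∷ w) = reverse w ∷ʳ ~-sym e

    pad : ∀ s {k i j} → Walk k i j → Walk (s + s + k) i j
    pad zero    w = w
    pad (suc s) {k} {i} w = cast (cong (λ q → suc (q + k)) (sym (+-suc s s)))
      (proj₂ (neighbour i) ∷ ~-sym (proj₂ (neighbour i)) ∷ pad s w)

    pad-to : ∀ {k K i j} → k ≤ K → parity k ≡ parity K → Walk k i j → Walk K i j
    pad-to k≤K p w with sameParity⇒+double k≤K p
    ... | s , refl = pad s w

    module Hub (_≟_ : DecidableEquality V) (h : V) {col : V → Bool}
               (alternates : ∀ {x y} → x ≢ h → y ≢ h → x ~ y → col y ≡ not (col x)) where

      record HubWalks (K : ℕ) (u : V) : Set where
        constructor hubWalks
        field
          even odd    : ℕ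
          even-parity : parity even ≡ false
          odd-parity  : parity odd ≡ true
          total       : even + odd ≡ suc K
          even-walk   : Walk even u h
          odd-walk    : Walk odd u h

      halves⇒hubWalks : ∀ {K u a c} → parity a xor parity c ≡ true → a + c ≡ suc K →
                        Walk a u h → Walk c u h → HubWalks K u
      halves⇒hubWalks {a = a} {c} odd a+c wa wc with parity a in pa
      ... | false = hubWalks a c pa odd a+c wa wc
      ... | true  = hubWalks c a (trans (sym (not-involutive _)) (cong not odd)) pa
                             (trans (+-comm c a) a+c) wc wa

      -- An odd closed walk cannot stay in the bipartite part, so it passes through h.
      odd-closed-walk⇒hubWalks : ∀ {K u} → parity K ≡ false → Walk (suc K) u u → HubWalks K u
      odd-closed-walk⇒hubWalks {K} {u} K-even w with meets-or-alternates (_≟ h) alternates w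
      ... | inj₂ eq with trans (sym (cong not K-even)) (xor-fixpoint (col u) _ eq)
      ...   | ()
      odd-closed-walk⇒hubWalks K-even w | inj₁ (via _ refl a c a+c w₁ w₂) =
        halves⇒hubWalks (trans (sym (parity-+ a c)) (trans (cong parity a+c) (cong not K-even)))
                        a+c w₁ (reverse w₂)

      -- Of the two even sums e + e′ and o + o′, of total 2(K + 1), one is at most K.
      hubWalks⇒walk : ∀ {K u v} → parity K ≡ false → HubWalks K u → HubWalks K v → Walk K u v
      hubWalks⇒walk {K} K-even (hubWalks e o pe po eo we wo) (hubWalks e′ o′ pe′ po′ eo′ we′ wo′) =
        [ (λ le → pad-to le evens (we ++ reverse we′))
        , (λ le → pad-to le odds (wo ++ reverse wo′))
        ]′ (sameParity-split total evens)
        where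
        evens : parity (e + e′) ≡ parity K
        evens = trans (parity-+ e e′) (trans (cong₂ _xor_ pe pe′) (sym K-even))
        odds : parity (o + o′) ≡ parity K
        odds = trans (parity-+ o o′) (trans (cong₂ _xor_ po po′) (sym K-even))
        interchange : ∀ a b c d → (a + b) + (c + d) ≡ (a + c) + (b + d)
        interchange = solve-∀
        total : (e + e′) + (o + o′) ≡ suc K + suc K
        total = trans (interchange e e′ o o′) (cong₂ _+_ eo eo′)

      odd-closed-walks⇒walks : ∀ {K} → parity K ≡ false →
                               (∀ u → Walk (suc K) u u) → ∀ u v → Walk K u v
      odd-closed-walks⇒walks K-even closed u v =
        hubWalks⇒walk K-even (odd-closed-walk⇒hubWalks K-even (closed u))
                             (odd-closed-walk⇒hubWalks K-even (closed v))

sumFin-positive⇒∃ : ∀ {m} (f : Fin m → ℕ) → 0 < sumFin f → ∃ λ l → 0 < f l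
sumFin-positive⇒∃ {suc m} f p with f Fin.zero in eq
... | suc _ = Fin.zero , ≤-trans (s≤s z≤n) (≤-reflexive (sym eq))
... | zero  with sumFin-positive⇒∃ (λ i → f (Fin.suc i)) p
...   | l , q = Fin.suc l , q

∃⇒sumFin-positive : ∀ {m} (f : Fin m → ℕ) l → 0 < f l → 0 < sumFin f
∃⇒sumFin-positive {suc m} f Fin.zero    p = ≤-trans p (m≤m+n _ _)
∃⇒sumFin-positive {suc m} f (Fin.suc l) p =
  ≤-trans (∃⇒sumFin-positive (λ i → f (Fin.suc i)) l p) (m≤n+m _ _)

*-positive : ∀ {m n} → 0 < m → 0 < n → 0 < m * n
*-positive {suc m} {suc n} _ _ = s≤s z≤n

*-positive⁻ : ∀ m n → 0 < m * n → 0 < m × 0 < n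
*-positive⁻ (suc m) (suc n) _ = s≤s z≤n , s≤s z≤n
*-positive⁻ (suc m) zero    p = ⊥-elim (<-irrefl (sym (*-zeroʳ (suc m))) p)

idMat-diagonal : ∀ {n} (i : Fin n) → 0 < idMat i i
idMat-diagonal i with toℕ i ≡ᵇ toℕ i in eq
... | true  = s≤s z≤n
... | false = ⊥-elim (subst T eq (≡⇒≡ᵇ (toℕ i) (toℕ i) refl))

idMat-positive⇒≡ : ∀ {n} {i j : Fin n} → 0 < idMat i j → i ≡ j
idMat-positive⇒≡ {i = i} {j} p with toℕ i ≡ᵇ toℕ j in eq
... | true = toℕ-injective (≡ᵇ⇒≡ (toℕ i) (toℕ j) (subst T (sym eq) _))

¬Positive-idMat : ∀ {n} → ¬ Positive (idMat {suc (suc n)})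
¬Positive-idMat p with p Fin.zero (Fin.suc Fin.zero)
... | ()

module MatrixWalks {n} (M : Mat n) where

  record _~_ (i j : Fin n) : Set where
    constructor adjacent
    field positive-entry : 0 < M i j

  open _~_ public

  open Walks _~_ public

  walk⇒positive : ∀ {k i j} → Walk k i j → 0 < (M ^ᴹ k) i j
  walk⇒positive {i = i} []                = idMat-diagonal i
  walk⇒positive         (_∷_ {l = l} e w) =
    ∃⇒sumFin-positive _ l (*-positive (positive-entry e) (walk⇒positive w))

  positive⇒walk : ∀ k {i j} → 0 < (M ^ᴹ k) i j → Walk k i j
  positive⇒walk zero {i} {j} p with idMat-positive⇒≡ {i = i} {j} p
  ... | refl = []
  positive⇒walk (suc k) {i} p with sumFin-positive⇒∃ _ p
  ... | l , q with *-positive⁻ (M i l) _ q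
  ...   | e , r = adjacent e ∷ positive⇒walk k r

  positive⇒walks : ∀ {k} → Positive (M ^ᴹ k) → ∀ i j → Walk k i j
  positive⇒walks {k} p i j = positive⇒walk k (p i j)

  walks⇒positive : ∀ {k} → (∀ i j → Walk k i j) → Positive (M ^ᴹ k)
  walks⇒positive ws i j = walk⇒positive (ws i j)

  positive-mono : (∀ i → ∃ (i ~_)) →
                  ∀ {k k′} → k ≤ k′ → Positive (M ^ᴹ k) → Positive (M ^ᴹ k′)
  positive-mono neighbour {k} k≤k′ p with m≤n⇒∃[o]m+o≡n k≤k′
  ... | d , refl = walks⇒positive (cast (+-comm d k) ∘₂ prepend d)
    where
    prepend : ∀ d i j → Walk (d + k) i j
    prepend zero    = positive⇒walks p
    prepend (suc d) i j = proj₂ (neighbour i) ∷ prepend d (proj₁ (neighbour i)) j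

-- n = P + 2, so the vertices are 0, …, N with N = P + 1; b is the last row of A.
module HubGraph (P : ℕ) (b : Fin (2 + P) → Bool) where

  N : ℕ
  N = suc P

  Vertex : Set
  Vertex = Fin (2 + P)

  A : Mat (2 + P)
  A = Fmap (Cmat (2 + P) b)

  open MatrixWalks A public

  toℕ≤N : ∀ (i : Vertex) → toℕ i ≤ N
  toℕ≤N = toℕ≤pred[n]

  vertex : ∀ p → p ≤ N → Vertex
  vertex p p≤N = Fin.fromℕ< (s≤s p≤N)

  toℕ-vertex : ∀ {p} (p≤N : p ≤ N) → toℕ (vertex p p≤N) ≡ p
  toℕ-vertex p≤N = toℕ-fromℕ< (s≤s p≤N)

  hub : Vertex
  hub = Fin.fromℕ N

  toℕ-hub : toℕ hub ≡ N
  toℕ-hub = toℕ-fromℕ N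

  toℕ≡N⇒hub : ∀ {i} → toℕ i ≡ N → i ≡ hub
  toℕ≡N⇒hub eq = toℕ-injective (trans eq (sym toℕ-hub))

  Cmat-positive⇒ : ∀ {i j} → 0 < Cmat (2 + P) b i j →
                   toℕ j ≡ suc (toℕ i) ⊎ (toℕ i ≡ N × b j ≡ true)
  Cmat-positive⇒ {i} {j} p
    with suc (toℕ i) ≤ᵇ N | ≤ᵇ-reflects-≤ (suc (toℕ i)) N
       | toℕ j ≡ᵇ suc (toℕ i) in next | b j in bj
  ... | true  | _       | true | _    = inj₁ (≡ᵇ⇒≡ (toℕ j) _ (subst T (sym next) _))
  ... | false | ofⁿ i≮N | _    | true = inj₂ (≤-antisym (toℕ≤N i) (≮⇒≥ i≮N) , refl)
  Cmat-positive⇒ () | true  | _ | false | _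
  Cmat-positive⇒ () | false | _ | _     | false

  step⇒Cmat-positive : ∀ {i j} → toℕ j ≡ suc (toℕ i) → 0 < Cmat (2 + P) b i j
  step⇒Cmat-positive {i} {j} eq
    with suc (toℕ i) ≤ᵇ N | ≤ᵇ-reflects-≤ (suc (toℕ i)) N | toℕ j ≡ᵇ suc (toℕ i) in next
  ... | true  | _       | true  = s≤s z≤n
  ... | true  | _       | false = ⊥-elim (subst T next (≡⇒≡ᵇ (toℕ j) _ eq))
  ... | false | ofⁿ i≮N | _     = ⊥-elim (i≮N (subst (_≤ N) eq (toℕ≤N j)))

  spoke⇒Cmat-positive : ∀ {i j} → toℕ i ≡ N → b j ≡ true → 0 < Cmat (2 + P) b i j
  spoke⇒Cmat-positive {i} {j} eq bj with suc (toℕ i) ≤ᵇ N | ≤ᵇ-reflects-≤ (suc (toℕ i)) N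
  ... | true  | ofʸ i<N = ⊥-elim (1+n≰n (subst (λ q → suc q ≤ N) eq i<N))
  ... | false | _       = subst (λ c → 0 < b2n c) (sym bj) (s≤s z≤n)

  data Edge (i j : Vertex) : Set where
    step   : toℕ j ≡ suc (toℕ i) → Edge i j
    step⁻  : toℕ i ≡ suc (toℕ j) → Edge i j
    spoke  : toℕ i ≡ N → b j ≡ true → Edge i j
    spoke⁻ : toℕ j ≡ N → b i ≡ true → Edge i j

  adjacent⇒Edge : ∀ {i j} → i ~ j → Edge i j
  adjacent⇒Edge {i} {j} (adjacent p) with Cmat (2 + P) b i j in eq
  ... | suc _ = Sum.[ step , uncurry spoke ]′ (Cmat-positive⇒ (subst (0 <_) (sym eq) (s≤s z≤n)))
  ... | zero  = Sum.[ step⁻ , uncurry spoke⁻ ]′ (Cmat-positive⇒ p)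

  Edge⇒adjacent : ∀ {i j} → Edge i j → i ~ j
  Edge⇒adjacent (step eq)      = adjacent (≤-trans (step⇒Cmat-positive eq) (m≤m+n _ _))
  Edge⇒adjacent (step⁻ eq)     = adjacent (≤-trans (step⇒Cmat-positive eq) (m≤n+m _ _))
  Edge⇒adjacent (spoke eq bj)  = adjacent (≤-trans (spoke⇒Cmat-positive eq bj) (m≤m+n _ _))
  Edge⇒adjacent (spoke⁻ eq bi) = adjacent (≤-trans (spoke⇒Cmat-positive eq bi) (m≤n+m _ _))

  ~-sym : Symmetric _~_
  ~-sym {i} {j} (adjacent p) =
    adjacent (subst (0 <_) (+-comm (Cmat (2 + P) b i j) (Cmat (2 + P) b j i)) p)

  neighbour : ∀ i → ∃ (i ~_)
  neighbour i with toℕ i ≟ N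
  ... | yes i≡N =
    vertex P (n≤1+n P) , Edge⇒adjacent (step⁻ (trans i≡N (cong suc (sym (toℕ-vertex (n≤1+n P))))))
  ... | no  i≢N = vertex (suc (toℕ i)) i<N , Edge⇒adjacent (step (toℕ-vertex i<N))
    where
    i<N : toℕ i < N
    i<N = ≤∧≢⇒< (toℕ≤N i) i≢N

  open Undirected ~-sym neighbour public

  path : ∀ d {i j} → toℕ i + d ≡ toℕ j → Walk d i j
  path zero {i} {j} eq with toℕ-injective {i = i} {j} (trans (sym (+-identityʳ (toℕ i))) eq)
  ... | refl = []
  path (suc d) {i} {j} eq = Edge⇒adjacent (step (toℕ-vertex i<N)) ∷ path d next+d
    where
    i+1+d : suc (toℕ i + d) ≡ toℕ j
    i+1+d = trans (sym (+-suc (toℕ i) d)) eq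
    i<N : toℕ i < N
    i<N = ≤-trans (s≤s (m≤m+n (toℕ i) d)) (subst (_≤ N) (sym i+1+d) (toℕ≤N j))
    next+d : toℕ (vertex (suc (toℕ i)) i<N) + d ≡ toℕ j
    next+d = trans (cong (_+ d) (toℕ-vertex i<N)) i+1+d

  parity-alternates-off-hub : ∀ {x y} → toℕ x ≢ N → toℕ y ≢ N → x ~ y →
                              parity (toℕ y) ≡ not (parity (toℕ x))
  parity-alternates-off-hub x≢N y≢N e with adjacent⇒Edge e
  ... | step eq       = cong parity eq
  ... | step⁻ eq      = suc-parity-flip eq
  ... | spoke x≡N _   = ⊥-elim (x≢N x≡N)
  ... | spoke⁻ y≡N _  = ⊥-elim (y≢N y≡N)

  open Hub Fin._≟_ hub (λ x≢h y≢h → parity-alternates-off-hub (x≢h ∘ toℕ≡N⇒hub) (y≢h ∘ toℕ≡N⇒hub))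
    public

  odd-closed-walks⇒positive : ∀ {K} → parity K ≡ false → (∀ u → Walk (suc K) u u) →
                              Positive (A ^ᴹ K)
  odd-closed-walks⇒positive K-even closed = walks⇒positive (odd-closed-walks⇒walks K-even closed)

  ≤P⊎hub : ∀ u → toℕ u ≤ P ⊎ u ≡ hub
  ≤P⊎hub u with toℕ u ≟ N
  ... | yes u≡N = inj₂ (toℕ≡N⇒hub u≡N)
  ... | no  u≢N = inj₁ (≤-pred (≤∧≢⇒< (toℕ≤N u) u≢N))

  -- The vertices of the cycle a — a+1 — ⋯ — c — N — a.
  OnCycle : Vertex → Vertex → Vertex → Set
  OnCycle a c u = (toℕ a ≤ toℕ u × toℕ u ≤ toℕ c) ⊎ u ≡ hub

  cycle-walk : ∀ {a c d} → toℕ a + d ≡ toℕ c → a ~ hub → c ~ hub →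
               ∀ {u} → OnCycle a c u → Walk (2 + d) u u
  cycle-walk {d = d} a+d ah ch (inj₂ refl) = ~-sym ah ∷ cast (+-comm d 1) (path d a+d ++ ch ∷ [])
  cycle-walk {a} {c} {d} a+d ah ch {u} (inj₁ (a≤u , u≤c))
    with m≤n⇒∃[o]m+o≡n a≤u | m≤n⇒∃[o]m+o≡n u≤c
  ... | p , a+p | q , u+q = cast length (path q u+q ++ ch ∷ ~-sym ah ∷ path p a+p)
    where
    d≡p+q : d ≡ p + q
    d≡p+q = +-cancelˡ-≡ (toℕ a) d (p + q)
              (trans a+d (trans (sym u+q) (trans (cong (_+ q) (sym a+p)) (+-assoc (toℕ a) p q))))
    length : q + (2 + p) ≡ 2 + d
    length = trans (+-comm q (2 + p)) (cong (2 +_) (sym d≡p+q))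

module Forward (P : ℕ) (b : Fin (2 + P) → Bool) (rows : RowCond (2 + P) true false b) where

  open HubGraph P b

  odd-power⇒even-power : ∀ K → parity K ≡ false → Positive (A ^ᴹ suc K) → Positive (A ^ᴹ K)
  odd-power⇒even-power K K-even p =
    odd-closed-walks⇒positive K-even (λ u → positive⇒walks {suc K} p u u)

  P≤N : P ≤ N
  P≤N = n≤1+n P

  last : Vertex
  last = vertex P P≤N

  zero~hub : Fin.zero ~ hub
  zero~hub = Edge⇒adjacent (spoke⁻ toℕ-hub (proj₁ rows Fin.zero refl))

  last~hub : last ~ hub
  last~hub = Edge⇒adjacent (step (trans toℕ-hub (cong suc (sym (toℕ-vertex P≤N)))))

  on-cycle-to-last : ∀ {a u} → toℕ a ≤ toℕ u → OnCycle a last u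
  on-cycle-to-last {u = u} a≤u with ≤P⊎hub u
  ... | inj₁ u≤P   = inj₁ (a≤u , subst (toℕ u ≤_) (sym (toℕ-vertex P≤N)) u≤P)
  ... | inj₂ u≡hub = inj₂ u≡hub

  closed-walks-full-cycle : ∀ u → Walk (suc N) u u
  closed-walks-full-cycle u =
    cycle-walk {a = Fin.zero} (sym (toℕ-vertex P≤N)) zero~hub last~hub (on-cycle-to-last z≤n)

  -- For N odd and an odd spoke s, the cycles 0 ⋯ s — N and s ⋯ N are odd and no longer than N.
  module OddSpoke (P-even : parity P ≡ false) (s : Vertex) (spoke-s : b s ≡ true)
                  (s-odd : parity (toℕ s) ≡ true) where

    N-odd : parity N ≡ true
    N-odd = cong not P-even

    s~hub : s ~ hub
    s~hub = Edge⇒adjacent (spoke⁻ toℕ-hub spoke-s)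

    s≤P : toℕ s ≤ P
    s≤P = ≤-pred (≤∧≢⇒< (toℕ≤N s) λ s≡N →
            not-¬ refl (trans (sym spoke-s) (proj₂ rows s s≡N)))

    s<P : toℕ s < P
    s<P = ≤∧≢⇒< s≤P λ s≡P → not-¬ refl (trans (sym s-odd) (trans (cong parity s≡P) P-even))

    lower-cycle : ∀ {u} → toℕ u ≤ toℕ s → Walk N u u
    lower-cycle u≤s = pad-to (s≤s s<P) (trans (cong (not ∘ not) s-odd) (sym N-odd))
      (cycle-walk {a = Fin.zero} refl zero~hub s~hub (inj₁ (z≤n , u≤s)))

    upper-cycle : ∀ {u} → toℕ s ≤ toℕ u → Walk N u u
    upper-cycle s≤u with m≤n⇒∃[o]m+o≡n s≤P
    ... | d , s+d = pad-to (s≤s (≤-trans (+-monoˡ-≤ d (odd⇒positive s-odd)) (≤-reflexive s+d)))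
                           (trans (cong not d-odd) (sym N-odd))
                           (cycle-walk (trans s+d (sym (toℕ-vertex P≤N))) s~hub last~hub
                                       (on-cycle-to-last s≤u))
      where
      d-odd : not (parity d) ≡ false
      d-odd = begin
        not (parity d)                ≡⟨ cong (_xor parity d) s-odd ⟨
        parity (toℕ s) xor parity d   ≡⟨ parity-+ (toℕ s) d ⟨
        parity (toℕ s + d)            ≡⟨ cong parity s+d ⟩
        parity P                      ≡⟨ P-even ⟩
        false                         ∎
        where open ≡-Reasoning

    closed-walks : ∀ u → Walk N u u
    closed-walks u with toℕ u ≤? toℕ s
    ... | yes u≤s = lower-cycle u≤s
    ... | no  u≰s = upper-cycle (<⇒≤ (≰⇒> u≰s))

  no-odd-spoke⇒alternating : parity P ≡ false → (∀ j → b j ≡ true → parity (toℕ j) ≡ false) →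
                             Alternating (parity ∘ toℕ)
  no-odd-spoke⇒alternating P-even even-spokes {x} {y} e = alternates (adjacent⇒Edge e)
    where
    N-odd : parity N ≡ true
    N-odd = cong not P-even
    alternates : Edge x y → parity (toℕ y) ≡ not (parity (toℕ x))
    alternates (step eq)            = cong parity eq
    alternates (step⁻ eq)           = suc-parity-flip eq
    alternates (spoke x≡N spoke-y)  =
      trans (even-spokes y spoke-y) (cong not (sym (trans (cong parity x≡N) N-odd)))
    alternates (spoke⁻ y≡N spoke-x) =
      trans (trans (cong parity y≡N) N-odd) (cong not (sym (even-spokes x spoke-x)))

  odd-spoke? : Dec (∃ λ j → b j ≡ true × parity (toℕ j) ≡ true)
  odd-spoke? = any? λ j → (b j Bool.≟ true) ×-dec (parity (toℕ j) Bool.≟ true)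

  positive⇒positive-≤N : ∀ {k} → Positive (A ^ᴹ k) → ∃ λ K → K ≤ N × Positive (A ^ᴹ K)
  positive⇒positive-≤N {k} p with parity P in P-parity | odd-spoke?
  ... | true  | _ =
    N , ≤-refl , odd-closed-walks⇒positive (cong not P-parity) closed-walks-full-cycle
  ... | false | yes (s , spoke-s , s-odd) =
    P , P≤N , odd-closed-walks⇒positive P-parity (OddSpoke.closed-walks P-parity s spoke-s s-odd)
  ... | false | no no-odd-spoke =
    ⊥-elim (alternating⇒¬equal-lengths (no-odd-spoke⇒alternating P-parity even-spokes) zero~one
              (positive⇒walks {k} p Fin.zero Fin.zero) (positive⇒walks {k} p Fin.zero one))
    where
    even-spokes : ∀ j → b j ≡ true → parity (toℕ j) ≡ false
    even-spokes j spoke-j = ¬-not λ j-odd → no-odd-spoke (j , spoke-j , j-odd)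
    one : Vertex
    one = vertex 1 (s≤s z≤n)
    zero~one : Fin.zero ~ one
    zero~one = Edge⇒adjacent (step (toℕ-vertex (s≤s z≤n)))

  exponent⇒even-≤N : ∀ {k} → IsExponent A k → ∃ λ t → 1 ≤ t × 2 * t ≤ N × k ≡ 2 * t
  exponent⇒even-≤N {zero}  (positive , _) = ⊥-elim (¬Positive-idMat positive)
  exponent⇒even-≤N {suc K} (positive , least) with parity K in K-parity
  ... | false = ⊥-elim (1+n≰n (least K (odd-power⇒even-power K K-parity positive)))
  ... | true with parity≡false⇒double (suc K) (cong not K-parity)
  ...   | suc t , k≡t+t = suc t , s≤s z≤n , subst (_≤ N) k≡2t k≤N , k≡2t
    where
    k≡2t : suc K ≡ 2 * suc t
    k≡2t = trans k≡t+t (cong (suc t +_) (sym (+-identityʳ (suc t))))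
    k≤N : suc K ≤ N
    k≤N with positive⇒positive-≤N {suc K} positive
    ... | K′ , K′≤N , positive′ = ≤-trans (least K′ positive′) K′≤N

∣n-1+n∣≡1 : ∀ n → ∣ n - suc n ∣ ≡ 1
∣n-1+n∣≡1 zero    = refl
∣n-1+n∣≡1 (suc n) = ∣n-1+n∣≡1 n

∣m-1+m∣≡1 : ∀ {m n} → n ≡ suc m → ∣ m - n ∣ ≡ 1
∣m-1+m∣≡1 {m} refl = ∣n-1+n∣≡1 m

∣-∣-lipschitz : ∀ x y c → ∣ x - y ∣ ≡ 1 → ∣ y - c ∣ ≤ suc ∣ x - c ∣
∣-∣-lipschitz x y c x~y =
  ≤-trans (∣-∣-triangle y x c) (≤-reflexive (cong (_+ ∣ x - c ∣) (trans (∣-∣-comm y x) x~y)))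

-- The spokes are 0 and m, m+1, …, N−1 with m = 2r + 1; the exponent is then 2(r + 1).
module Backward (P r : ℕ) (fits : 2 * suc r ≤ suc P) where

  t m : ℕ
  t = suc r
  m = suc (r + r)

  2t≡1+m : 2 * t ≡ suc m
  2t≡1+m = cong suc (trans (cong (r +_) (+-identityʳ t)) (+-suc r r))

  Spoke : ℕ → Set
  Spoke p = p ≡ 0 ⊎ (m ≤ p × p < suc P)

  spoke? : Decidable Spoke
  spoke? p = (p ≟ 0) ⊎-dec ((m ≤? p) ×-dec (p <? suc P))

  b : Fin (2 + P) → Bool
  b j = does (spoke? (toℕ j))

  open HubGraph P b

  m<N : m < N
  m<N = subst (_≤ N) 2t≡1+m fits

  m-odd : parity m ≡ true
  m-odd = cong not (parity-double r)

  spoke⇒b : ∀ {j} → Spoke (toℕ j) → b j ≡ true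
  spoke⇒b {j} = dec-true (spoke? (toℕ j))

  b⇒spoke : ∀ {j} → b j ≡ true → Spoke (toℕ j)
  b⇒spoke {j} = does⇒ (spoke? (toℕ j))

  b-zero : ∀ j → toℕ j ≡ 0 → b j ≡ true
  b-zero j j≡0 = spoke⇒b (inj₁ j≡0)

  b-hub : ∀ j → toℕ j ≡ N → b j ≡ false
  b-hub j j≡N = dec-false (spoke? (toℕ j)) λ where
    (inj₁ j≡0)       → case trans (sym j≡N) j≡0 of λ ()
    (inj₂ (_ , j<N)) → <-irrefl j≡N j<N

  inner-spoke : ∀ {j} → m ≤ toℕ j → toℕ j < N → j ~ hub
  inner-spoke m≤j j<N = Edge⇒adjacent (spoke⁻ toℕ-hub (spoke⇒b (inj₂ (m≤j , j<N))))

  mid : Vertex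
  mid = vertex m (<⇒≤ m<N)

  toℕ-mid : toℕ mid ≡ m
  toℕ-mid = toℕ-vertex (<⇒≤ m<N)

  long-cycle : ∀ {u} → OnCycle Fin.zero mid u → Walk (2 + m) u u
  long-cycle = cycle-walk (sym toℕ-mid) (Edge⇒adjacent (spoke⁻ toℕ-hub (b-zero Fin.zero refl)))
                          (inner-spoke (≤-reflexive (sym toℕ-mid)) (subst (_< N) (sym toℕ-mid) m<N))

  triangle : ∀ {u} → m < toℕ u → toℕ u ≤ P → Walk (2 + m) u u
  triangle {u} m<u u≤P with m≤n⇒∃[o]m+o≡n m<u
  ... | d , m+1+d =
    pad-to (s≤s (s≤s (s≤s z≤n))) (cong (not ∘ not) (sym m-odd))
      (cycle-walk {d = 1} pred+1 (inner-spoke m≤pred pred<N) (inner-spoke (<⇒≤ m<u) (s≤s u≤P))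
                  (inj₁ (<⇒≤ pred<u , ≤-refl)))
    where
    pred≤N : m + d ≤ N
    pred≤N = ≤-trans (<⇒≤ (≤-reflexive m+1+d)) (≤-trans u≤P (n≤1+n P))
    pred : Vertex
    pred = vertex (m + d) pred≤N
    toℕ-pred : toℕ pred ≡ m + d
    toℕ-pred = toℕ-vertex pred≤N
    pred<u : toℕ pred < toℕ u
    pred<u = ≤-reflexive (trans (cong suc toℕ-pred) m+1+d)
    m≤pred : m ≤ toℕ pred
    m≤pred = subst (m ≤_) (sym toℕ-pred) (m≤m+n m d)
    pred<N : toℕ pred < N
    pred<N = ≤-trans pred<u (≤-trans u≤P (n≤1+n P))
    pred+1 : toℕ pred + 1 ≡ toℕ u
    pred+1 = trans (+-comm (toℕ pred) 1) (trans (cong suc toℕ-pred) m+1+d)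

  closed-walk : ∀ u → Walk (2 + m) u u
  closed-walk u with toℕ u ≤? m | ≤P⊎hub u
  ... | yes u≤m | _          = long-cycle (inj₁ (z≤n , subst (toℕ u ≤_) (sym toℕ-mid) u≤m))
  ... | no _    | inj₂ u≡hub = long-cycle (inj₂ u≡hub)
  ... | no u≰m  | inj₁ u≤P   = triangle (≰⇒> u≰m) u≤P

  positive-2t : Positive (A ^ᴹ (2 * t))
  positive-2t = subst (λ k → Positive (A ^ᴹ k)) (sym 2t≡1+m)
                      (odd-closed-walks⇒positive (cong not m-odd) closed-walk)

  φ : Vertex → ℕ
  φ x = ∣ toℕ x - r ∣ ⊓ t

  far : ∀ {x} → m ≤ toℕ x → t ≤ φ x
  far {x} m≤x = ⊓-glb (begin
    t                  ≡⟨ m+n∸n≡m t r ⟨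
    m ∸ r              ≤⟨ ∸-monoˡ-≤ r m≤x ⟩
    toℕ x ∸ r          ≤⟨ m∸n≤∣m-n∣ (toℕ x) r ⟩
    ∣ toℕ x - r ∣      ∎) ≤-refl
    where open ≤-Reasoning

  spoke-or-hub⇒r≤φ : ∀ {x} → Spoke (toℕ x) ⊎ toℕ x ≡ N → r ≤ φ x
  spoke-or-hub⇒r≤φ {x} (inj₁ (inj₁ x≡0)) =
    subst (λ p → r ≤ ∣ p - r ∣ ⊓ t) (sym x≡0) (⊓-glb ≤-refl (n≤1+n r))
  spoke-or-hub⇒r≤φ (inj₁ (inj₂ (m≤x , _))) = ≤-trans (n≤1+n r) (far m≤x)
  spoke-or-hub⇒r≤φ (inj₂ x≡N) = ≤-trans (n≤1+n r) (far (subst (m ≤_) (sym x≡N) (<⇒≤ m<N)))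

  r≤φ⇒φ-lipschitz : ∀ x y → r ≤ φ x → φ y ≤ suc (φ x)
  r≤φ⇒φ-lipschitz x y r≤φx = ≤-trans (m⊓n≤n ∣ toℕ y - r ∣ t) (s≤s r≤φx)

  φ-lipschitz : ∀ {x y} → x ~ y → φ y ≤ suc (φ x)
  φ-lipschitz {x} {y} e with adjacent⇒Edge e
  ... | step eq  = ⊓-mono-≤ (∣-∣-lipschitz (toℕ x) (toℕ y) r (∣m-1+m∣≡1 eq)) (n≤1+n t)
  ... | step⁻ eq = ⊓-mono-≤ (∣-∣-lipschitz (toℕ x) (toℕ y) r
                              (trans (∣-∣-comm (toℕ x) (toℕ y)) (∣m-1+m∣≡1 eq))) (n≤1+n t)
  ... | spoke x≡N _      = r≤φ⇒φ-lipschitz x y (spoke-or-hub⇒r≤φ {x} (inj₂ x≡N))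
  ... | spoke⁻ _ spoke-x = r≤φ⇒φ-lipschitz x y (spoke-or-hub⇒r≤φ {x} (inj₁ (b⇒spoke spoke-x)))

  r≤N : r ≤ N
  r≤N = ≤-trans (n≤1+n r) (≤-trans (m≤m+n t (t + 0)) fits)

  centre : Vertex
  centre = vertex r r≤N

  φ-centre : φ centre ≡ 0
  φ-centre = cong (_⊓ t) (trans (cong ∣_- r ∣ (toℕ-vertex r≤N)) (∣n-n∣≡0 r))

  below-m-alternates : ∀ {x y} → ¬ m ≤ toℕ x → ¬ m ≤ toℕ y → x ~ y →
                       parity (toℕ y) ≡ not (parity (toℕ x))
  below-m-alternates x<m y<m = parity-alternates-off-hub (x<m ∘ m≤N) (y<m ∘ m≤N)
    where
    m≤N : ∀ {p} → p ≡ N → m ≤ p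
    m≤N p≡N = subst (m ≤_) (sym p≡N) (<⇒≤ m<N)

  -- A closed walk of odd length m at the centre must reach the interval [m, N], but φ rises
  -- by at most one per step and is 0 at the centre and t on that interval.
  ¬positive-m : ¬ Positive (A ^ᴹ m)
  ¬positive-m p
    with meets-or-alternates (λ x → m ≤? toℕ x) below-m-alternates (positive⇒walks {m} p centre centre)
  ... | inj₂ eq = not-¬ refl (trans (sym m-odd) (xor-fixpoint _ _ eq))
  ... | inj₁ (via x m≤x a c a+c w₁ w₂) = 1+n≰n (begin
    suc m   ≡⟨ cong suc (+-suc r r) ⟨
    t + t   ≤⟨ +-mono-≤ (reach w₁) (reach (reverse w₂)) ⟩
    a + c   ≡⟨ a+c ⟩
    m       ∎)
    where
    open ≤-Reasoning
    reach : ∀ {k} → Walk k centre x → t ≤ k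
    reach {k} w = begin
      t              ≤⟨ far m≤x ⟩
      φ x            ≤⟨ potential-≤ φ φ-lipschitz w ⟩
      k + φ centre   ≡⟨ cong (k +_) φ-centre ⟩
      k + 0          ≡⟨ +-identityʳ k ⟩
      k              ∎

  exponent : IsExponent A (2 * t)
  exponent = positive-2t , least
    where
    least : ∀ k → Positive (A ^ᴹ k) → 2 * t ≤ k
    least k p with 2 * t ≤? k
    ... | yes 2t≤k = 2t≤k
    ... | no  2t≰k = ⊥-elim (¬positive-m (positive-mono neighbour k≤m p))
      where
      k≤m : k ≤ m
      k≤m = ≤-pred (subst (k <_) 2t≡1+m (≰⇒> 2t≰k))

  2t∈E : InE-PSC (2 + P) true false (2 * t)
  2t∈E = b , (b-zero , b-hub) , (2 * t , positive-2t) , exponent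

2*≤⇔≤/2 : ∀ t n → 2 * t ≤ n ⇔ t ≤ n / 2
2*≤⇔≤/2 t n = mk⇔
  (λ 2t≤n → subst (_≤ n / 2) (m*n/n≡m t 2) (/-monoˡ-≤ 2 (subst (_≤ n) (*-comm 2 t) 2t≤n)))
  (λ t≤n/2 → ≤-trans (≤-reflexive (*-comm 2 t)) (≤-trans (*-monoˡ-≤ 2 t≤n/2) (m/n*n≤m n 2)))

theorem4 : (n : ℕ) → 4 ≤ n → (k : ℕ) →
    InE-PSC n true false k ⇔ (∃ λ t → 1 ≤ t × t ≤ (n ∸ 1) / 2 × k ≡ 2 * t)
theorem4 (suc zero) (s≤s ()) k
theorem4 (suc (suc P)) _ k = mk⇔ forward backward
  where
  forward : InE-PSC (2 + P) true false k → ∃ λ t → 1 ≤ t × t ≤ suc P / 2 × k ≡ 2 * t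
  forward (b , rows , _ , exponent) with Forward.exponent⇒even-≤N P b rows exponent
  ... | t , 1≤t , 2t≤N , k≡2t = t , 1≤t , Equivalence.to (2*≤⇔≤/2 t (suc P)) 2t≤N , k≡2t
  backward : (∃ λ t → 1 ≤ t × t ≤ suc P / 2 × k ≡ 2 * t) → InE-PSC (2 + P) true false k
  backward (suc r , _ , t≤N/2 , refl) =
    Backward.2t∈E P r (Equivalence.from (2*≤⇔≤/2 (suc r) (suc P)) t≤N/2)
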